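{- Let $d \geq 3$ be an integer. There exist constants $C>0$ and $c>0$ (depending only on $d$) such that the following holds. Let $q$ be an odd prime power, let $\mathbb{F}_q$ be the finite field with $q$ elements, and let \[S^{d-1} = \{x \in \mathbb{F}_q^d : x_1^2 + \cdots + x_d^2 = 1\}\] be the unit sphere in $\mathbb{F}_q^d$. If $E \subset S^{d-1}$ satisfies $|E| \geq C q^{d/2}$, then the distance set \[\Delta(E) = \{\|x-y\| : x,y \in E\} \subset \mathbb{F}_q\] satisfies $|\Delta(E)| > c q$.
   Context: For $x,y \in \mathbb{F}_q^d$, the (finite-field) distance is defined as $\|x-y\| = (x_1-y_1)^2 + \cdots + (x_d-y_d)^2 \in \mathbb{F}_q$; it is an element of $\mathbb{F}_q$, not a norm. The constants $C$ (taken sufficiently large) and $c$ do not depend on $q$ or $E$. -}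

module Defs where

open import Level using (0ℓ)
open import Data.Nat as ℕ using (ℕ; _≤_)
open import Data.Nat.Divisibility using (_∣_)
open import Data.Nat.Primality using (Prime)
open import Data.Fin using (Fin)
open import Data.Fin.Properties as FinP using ()
open import Data.Vec using (Vec; []; _∷_; zipWith; foldr)
open import Data.List as List using (List; length; concatMap; deduplicate)
open import Data.Product using (∃; ∃-syntax; _×_; _,_)
open import Data.Integer using (+_)
open import Data.Rational as ℚ using (ℚ)
open import Relation.Binary.PropositionalEquality using (_≡_; refl; cong; trans; sym)
open import Relation.Binary.Definitions using (DecidableEquality)
open import Relation.Nullary using (¬_; yes; no)
open import Algebra.Core using (Op₁; Op₂)
open import Algebra.Structures using (IsCommutativeRing)
open import Function.Bundles using (_↔_; Inverse)

record Field : Set₁ where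
  infixl 6 _+_
  infixl 7 _*_
  field
    Carrier : Set
    _+_ _*_ : Op₂ Carrier
    -_      : Op₁ Carrier
    0# 1#   : Carrier
    isCommutativeRing : IsCommutativeRing _≡_ _+_ _*_ -_ 0# 1#
    0≢1     : ¬ (0# ≡ 1#)
    inverse : ∀ x → ¬ (x ≡ 0#) → ∃[ y ] (x * y ≡ 1#)

  _-_ : Op₂ Carrier
  x - y = x + (- y)

record FiniteField (q : ℕ) : Set₁ where
  field
    field′ : Field
  open Field field′ public
  field
    enum : Fin q ↔ Carrier

  _≟_ : DecidableEquality Carrier
  x ≟ y with FinP._≟_ (Inverse.from enum x) (Inverse.from enum y)
  ... | yes p = yes (trans (sym (Inverse.strictlyInverseˡ enum x)) (trans (cong (Inverse.to enum) p) (Inverse.strictlyInverseˡ enum y)))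
  ... | no ¬p = no λ e → ¬p (cong (Inverse.from enum) e)

OddPrimePower : ℕ → Set
OddPrimePower q = (∃[ p ] ∃[ k ] (Prime p × 1 ≤ k × q ≡ p ℕ.^ k)) × ¬ (2 ∣ q)

module _ {q : ℕ} (F : FiniteField q) where
  open FiniteField F

  sumSq : ∀ {d} → Vec Carrier d → Carrier
  sumSq = foldr _ (λ a s → a * a + s) 0#

  dist : ∀ {d} → Vec Carrier d → Vec Carrier d → Carrier
  dist x y = sumSq (zipWith _-_ x y)

  OnSphere : ∀ {d} → Vec Carrier d → Set
  OnSphere x = sumSq x ≡ 1#

  distanceSetSize : ∀ {d} → List (Vec Carrier d) → ℕ
  distanceSetSize E =
    length (deduplicate _≟_ (concatMap (λ x → List.map (λ y → dist x y) E) E))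

toℚ : ℕ → ℚ
toℚ n = (+ n) ℚ./ 1

module Submission where

-- Let E ⊆ S^{d-1} have N points and let Q = #{(x , x' , y , y') ∈ E⁴ :
-- x·y = x'·y'}. On the sphere ‖x - y‖ = 2 - 2 x·y, so for odd q (2 ≠ 0)
-- distance coincidences are dot-product coincidences, and Cauchy–Schwarz over
-- the values of the distance gives (2) N⁴ ≤ |Δ(E)| Q. For the upper bound on Q,
-- write ν(t) = #{(x , y) : x·y = t}; then q(qQ - N⁴) = Σ_t (q ν t - N²)², and
-- Cauchy–Schwarz over x reduces this to Σ_{x ∈ E} W x, where W ξ measures
-- how unevenly the hyperplanes ξ·y = t split E. W is invariant under
-- dilations, its total over F_q^d is computed by counting hyperplanes, and
-- each ξ is a dilate s x of at most two points of E; this gives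
-- (1) q Q - N⁴ ≤ 2 N² q^d. With N² ≥ 4 q^d, (1) and (2) give 2q ≤ 3|Δ(E)|,
-- so C = 2 and c = 1/2 work (for every d ≥ 1).

module Sums where

  open import Data.Nat as ℕ using (suc)
  open import Data.Integer as ℤ using (ℤ; +_; _+_; _*_; -_; _-_; _≤_; 0ℤ; 1ℤ; +≤+)
  import Data.Integer.Properties as ℤP
  open import Data.Integer.Tactic.RingSolver using (solve-∀)
  open import Data.List using (List; []; _∷_; length; map; _++_; concatMap)
  open import Data.List.Membership.Propositional using (_∈_)
  open import Data.List.Relation.Unary.Any using (here; there)
  import Data.List.Relation.Unary.All as All
  open import Data.List.Relation.Unary.Unique.Propositional using (Unique)
  open import Data.List.Relation.Unary.AllPairs using (_∷_)
  open import Relation.Binary.PropositionalEquality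
  open import Relation.Nullary using (Dec; yes; no; ¬_)
  open import Relation.Binary.Definitions using (DecidableEquality)
  open import Data.Empty using (⊥-elim)

  Σ : {A : Set} → List A → (A → ℤ) → ℤ
  Σ [] f = 0ℤ
  Σ (x ∷ xs) f = f x + Σ xs f

  module _ {A : Set} where
    Σ-cong : ∀ (xs : List A) {f g : A → ℤ} → (∀ {x} → x ∈ xs → f x ≡ g x) → Σ xs f ≡ Σ xs g
    Σ-cong [] h = refl
    Σ-cong (x ∷ xs) h = cong₂ _+_ (h (here refl)) (Σ-cong xs (λ m → h (there m)))

    Σ-cong′ : ∀ (xs : List A) {f g : A → ℤ} → (∀ x → f x ≡ g x) → Σ xs f ≡ Σ xs g
    Σ-cong′ xs h = Σ-cong xs (λ {x} _ → h x)

    Σ-+ : ∀ (xs : List A) (f g : A → ℤ) → Σ xs (λ x → f x + g x) ≡ Σ xs f + Σ xs g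
    Σ-+ [] f g = refl
    Σ-+ (x ∷ xs) f g rewrite Σ-+ xs f g = interchange (f x) (g x) (Σ xs f) (Σ xs g)
      where
        interchange : ∀ a b c d → (a + b) + (c + d) ≡ (a + c) + (b + d)
        interchange = solve-∀

    Σ-*ˡ : ∀ (xs : List A) (c : ℤ) (f : A → ℤ) → Σ xs (λ x → c * f x) ≡ c * Σ xs f
    Σ-*ˡ [] c f = sym (ℤP.*-zeroʳ c)
    Σ-*ˡ (x ∷ xs) c f rewrite Σ-*ˡ xs c f = sym (ℤP.*-distribˡ-+ c (f x) (Σ xs f))

    Σ-*ʳ : ∀ (xs : List A) (c : ℤ) (f : A → ℤ) → Σ xs (λ x → f x * c) ≡ Σ xs f * c
    Σ-*ʳ xs c f = trans (Σ-cong′ xs (λ x → ℤP.*-comm (f x) c)) (trans (Σ-*ˡ xs c f) (ℤP.*-comm c _))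

    Σ-neg : ∀ (xs : List A) (f : A → ℤ) → Σ xs (λ x → - f x) ≡ - Σ xs f
    Σ-neg [] f = refl
    Σ-neg (x ∷ xs) f rewrite Σ-neg xs f = sym (ℤP.neg-distrib-+ (f x) (Σ xs f))

    Σ-const : ∀ (xs : List A) (c : ℤ) → Σ xs (λ _ → c) ≡ + length xs * c
    Σ-const [] c = refl
    Σ-const (x ∷ xs) c rewrite Σ-const xs c = step (length xs)
      where
        step : ∀ n → c + + n * c ≡ + suc n * c
        step n = sym (trans (cong (_* c) (ℤP.pos-+ 1 n))
                            (trans (ℤP.*-distribʳ-+ c (+ 1) (+ n)) (cong (_+ + n * c) (ℤP.*-identityˡ c))))

    Σ-0 : ∀ (xs : List A) {f : A → ℤ} → (∀ {x} → x ∈ xs → f x ≡ 0ℤ) → Σ xs f ≡ 0ℤ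
    Σ-0 xs h = trans (Σ-cong xs h) (trans (Σ-const xs 0ℤ) (ℤP.*-zeroʳ (+ length xs)))

    Σ-mono : ∀ (xs : List A) {f g : A → ℤ} → (∀ {x} → x ∈ xs → f x ≤ g x) → Σ xs f ≤ Σ xs g
    Σ-mono [] h = ℤP.≤-refl
    Σ-mono (x ∷ xs) h = ℤP.+-mono-≤ (h (here refl)) (Σ-mono xs (λ m → h (there m)))

    Σ-nonneg : ∀ (xs : List A) {f : A → ℤ} → (∀ {x} → x ∈ xs → 0ℤ ≤ f x) → 0ℤ ≤ Σ xs f
    Σ-nonneg xs {f} h = subst (_≤ Σ xs f) (Σ-0 xs {λ _ → 0ℤ} (λ _ → refl)) (Σ-mono xs h)

    Σ-++ : ∀ (xs ys : List A) (f : A → ℤ) → Σ (xs ++ ys) f ≡ Σ xs f + Σ ys f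
    Σ-++ [] ys f = sym (ℤP.+-identityˡ _)
    Σ-++ (x ∷ xs) ys f rewrite Σ-++ xs ys f = sym (ℤP.+-assoc (f x) _ _)

  module _ {A B : Set} where
    Σ-map : ∀ (h : A → B) (xs : List A) (f : B → ℤ) → Σ (map h xs) f ≡ Σ xs (λ x → f (h x))
    Σ-map h [] f = refl
    Σ-map h (x ∷ xs) f = cong (λ z → f (h x) + z) (Σ-map h xs f)

    Σ-concatMap : ∀ (h : A → List B) (xs : List A) (f : B → ℤ) →
      Σ (concatMap h xs) f ≡ Σ xs (λ x → Σ (h x) f)
    Σ-concatMap h [] f = refl
    Σ-concatMap h (x ∷ xs) f =
      trans (Σ-++ (h x) (concatMap h xs) f) (cong (λ z → Σ (h x) f + z) (Σ-concatMap h xs f))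

    Σ-swap : ∀ (xs : List A) (ys : List B) (f : A → B → ℤ) →
      Σ xs (λ x → Σ ys (λ y → f x y)) ≡ Σ ys (λ y → Σ xs (λ x → f x y))
    Σ-swap [] ys f = sym (Σ-0 ys (λ _ → refl))
    Σ-swap (x ∷ xs) ys f rewrite Σ-swap xs ys f = sym (Σ-+ ys (f x) (λ y → Σ xs (λ x → f x y)))

    Σ-mul : ∀ (xs : List A) (ys : List B) (f : A → ℤ) (g : B → ℤ) →
      Σ xs f * Σ ys g ≡ Σ xs (λ x → Σ ys (λ y → f x * g y))
    Σ-mul xs ys f g = trans (sym (Σ-*ʳ xs (Σ ys g) f)) (Σ-cong′ xs (λ x → sym (Σ-*ˡ ys (f x) g)))

  χ : {P : Set} → Dec P → ℤ
  χ (yes _) = 1ℤ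
  χ (no _) = 0ℤ

  module _ {P : Set} where
    χ-yes : (d : Dec P) → P → χ d ≡ 1ℤ
    χ-yes (yes _) p = refl
    χ-yes (no ¬p) p = ⊥-elim (¬p p)

    χ-no : (d : Dec P) → ¬ P → χ d ≡ 0ℤ
    χ-no (yes p) ¬p = ⊥-elim (¬p p)
    χ-no (no _) ¬p = refl

    χ-nonneg : (d : Dec P) → 0ℤ ≤ χ d
    χ-nonneg (yes _) = +≤+ ℕ.z≤n
    χ-nonneg (no _) = +≤+ ℕ.z≤n

  χ-iff : {P Q : Set} (d : Dec P) (e : Dec Q) → (P → Q) → (Q → P) → χ d ≡ χ e
  χ-iff (yes p) (yes q) f g = refl
  χ-iff (yes p) (no ¬q) f g = ⊥-elim (¬q (f p))
  χ-iff (no ¬p) (yes q) f g = ⊥-elim (¬p (g q))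
  χ-iff (no ¬p) (no ¬q) f g = refl

  sq-nonneg : ∀ i → 0ℤ ≤ i * i
  sq-nonneg (+ n) = subst (0ℤ ≤_) (ℤP.pos-* n n) (+≤+ ℕ.z≤n)
  sq-nonneg ℤ.-[1+ n ] = +≤+ ℕ.z≤n

  module Delta {A : Set} (_≟_ : DecidableEquality A) where
    Σ-δ : ∀ (L : List A) → Unique L → (u : A) (g : A → ℤ) → u ∈ L → Σ L (λ v → χ (u ≟ v) * g v) ≡ g u
    Σ-δ (a ∷ L) (a∉ ∷ uL) u g (here refl) =
      trans (cong₂ _+_ (cong (_* g u) (χ-yes (u ≟ u) refl))
              (Σ-0 L (λ {v} v∈ → cong (_* g v) (χ-no (u ≟ v) (λ e → All.lookup a∉ v∈ e)))))
            (trans (ℤP.+-identityʳ _) (ℤP.*-identityˡ _))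
    Σ-δ (a ∷ L) (a∉ ∷ uL) u g (there u∈) =
      trans (cong₂ _+_ (cong (_* g a) (χ-no (u ≟ a) (λ e → All.lookup a∉ u∈ (sym e)))) (Σ-δ L uL u g u∈))
            (ℤP.+-identityˡ _)

    Σ-δ-1 : ∀ (L : List A) → Unique L → (u : A) → u ∈ L → Σ L (λ v → χ (u ≟ v)) ≡ 1ℤ
    Σ-δ-1 L uL u u∈ = trans (Σ-cong′ L (λ v → sym (ℤP.*-identityʳ _))) (Σ-δ L uL u (λ _ → 1ℤ) u∈)

    injective-hits≤1 : ∀ {B : Set} (L : List B) → Unique L → (f : B → A) →
      (∀ {a b} → f a ≡ f b → a ≡ b) → (v : A) → Σ L (λ x → χ (f x ≟ v)) ≤ 1ℤ
    injective-hits≤1 [] uL f inj v = +≤+ ℕ.z≤n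
    injective-hits≤1 (a ∷ L) (a∉ ∷ uL) f inj v with f a ≟ v
    ... | yes e = ℤP.≤-reflexive (cong (λ z → 1ℤ + z) (Σ-0 L (λ {x} x∈ →
                    χ-no (f x ≟ v) (λ e' → All.lookup a∉ x∈ (inj (trans e (sym e')))))))
    ... | no _ = subst (_≤ 1ℤ) (sym (ℤP.+-identityˡ _)) (injective-hits≤1 L uL f inj v)

  module _ {A : Set} where
    pairsSq : List A → (A → ℤ) → ℤ
    pairsSq [] f = 0ℤ
    pairsSq (a ∷ l) f = Σ l (λ b → (f a - f b) * (f a - f b)) + pairsSq l f

    pairsSq-nonneg : ∀ xs f → 0ℤ ≤ pairsSq xs f
    pairsSq-nonneg [] f = ℤP.≤-refl
    pairsSq-nonneg (a ∷ l) f =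
      ℤP.+-mono-≤ (Σ-nonneg l (λ {b} _ → sq-nonneg (f a - f b))) (pairsSq-nonneg l f)

    row-expand : ∀ (l : List A) f a → Σ l (λ b → (f a - f b) * (f a - f b))
               ≡ + length l * (f a * f a) + (- (f a + f a)) * Σ l f + Σ l (λ b → f b * f b)
    row-expand l f a = begin
        Σ l (λ b → (f a - f b) * (f a - f b))
      ≡⟨ Σ-cong′ l (λ b → square-expand (f a) (f b)) ⟩
        Σ l (λ b → (f a * f a + (- (f a + f a)) * f b) + f b * f b)
      ≡⟨ Σ-+ l _ _ ⟩
        Σ l (λ b → f a * f a + (- (f a + f a)) * f b) + Σ l (λ b → f b * f b)
      ≡⟨ cong (_+ Σ l (λ b → f b * f b))
              (trans (Σ-+ l _ _) (cong₂ _+_ (Σ-const l _) (Σ-*ˡ l (- (f a + f a)) f))) ⟩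
        + length l * (f a * f a) + (- (f a + f a)) * Σ l f + Σ l (λ b → f b * f b) ∎
      where
        open ≡-Reasoning
        square-expand : ∀ a b → (a - b) * (a - b) ≡ a * a + (- (a + a)) * b + b * b
        square-expand = solve-∀

    lagrange : ∀ xs f → + length xs * Σ xs (λ x → f x * f x) ≡ Σ xs f * Σ xs f + pairsSq xs f
    lagrange [] f = refl
    lagrange (a ∷ l) f =
      let n = + length l ; S = Σ l f ; T = Σ l (λ x → f x * f x) in
      begin
        + suc (length l) * (f a * f a + T)
      ≡⟨ cong (_* (f a * f a + T)) (ℤP.pos-+ 1 (length l)) ⟩
        (1ℤ + n) * (f a * f a + T)
      ≡⟨ regroup n (f a) S T ⟩
        (f a + S) * (f a + S) + ((n * (f a * f a) + (- (f a + f a)) * S + T) + (n * T - S * S))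
      ≡⟨ cong (λ z → (f a + S) * (f a + S) + z)
              (cong₂ _+_ (sym (row-expand l f a)) (sym (isolate _ _ _ (lagrange l f)))) ⟩
        (f a + S) * (f a + S) + pairsSq (a ∷ l) f ∎
      where
        open ≡-Reasoning
        regroup : ∀ n a S T → (1ℤ + n) * (a * a + T)
                ≡ (a + S) * (a + S) + ((n * (a * a) + (- (a + a)) * S + T) + (n * T - S * S))
        regroup = solve-∀
        cancel-+ : ∀ y z → (y + z) - y ≡ z
        cancel-+ = solve-∀
        isolate : ∀ x y z → x ≡ y + z → z ≡ x - y
        isolate x y z e = trans (sym (cancel-+ y z)) (cong (_- y) (sym e))

    cauchy-schwarz : ∀ xs f → Σ xs f * Σ xs f ≤ + length xs * Σ xs (λ x → f x * f x)
    cauchy-schwarz xs f =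
      subst (Σ xs f * Σ xs f ≤_) (sym (lagrange xs f))
        (subst (_≤ Σ xs f * Σ xs f + pairsSq xs f) (ℤP.+-identityʳ _)
          (ℤP.+-monoʳ-≤ (Σ xs f * Σ xs f) (pairsSq-nonneg xs f)))

    variance : ∀ (L : List A) (f : A → ℤ) → let n = + length L ; S = Σ L f in
      Σ L (λ t → (n * f t - S) * (n * f t - S)) ≡ n * (n * Σ L (λ t → f t * f t) - S * S)
    variance L f = begin
        Σ L (λ t → (n * f t - S) * (n * f t - S))
      ≡⟨ Σ-cong′ L (λ t → pointwise n S (f t)) ⟩
        Σ L (λ t → (n * n) * (f t * f t) + (- (n * S + n * S) * f t + S * S))
      ≡⟨ Σ-+ L _ _ ⟩
        Σ L (λ t → (n * n) * (f t * f t)) + Σ L (λ t → - (n * S + n * S) * f t + S * S)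
      ≡⟨ cong₂ _+_ (Σ-*ˡ L (n * n) _) (trans (Σ-+ L _ _) (cong₂ _+_ (Σ-*ˡ L (- (n * S + n * S)) f) (Σ-const L (S * S)))) ⟩
        (n * n) * T + (- (n * S + n * S) * S + n * (S * S))
      ≡⟨ collect n S T ⟩
        n * (n * T - S * S) ∎
      where
        open ≡-Reasoning
        n S T : ℤ
        n = + length L
        S = Σ L f
        T = Σ L (λ t → f t * f t)
        pointwise : ∀ n S x → (n * x - S) * (n * x - S) ≡ (n * n) * (x * x) + (- (n * S + n * S) * x + S * S)
        pointwise = solve-∀
        collect : ∀ n S T → (n * n) * T + (- (n * S + n * S) * S + n * (S * S)) ≡ n * (n * T - S * S)
        collect = solve-∀

  module Fibres {K : Set} (_≟_ : DecidableEquality K) (L : List K) (uL : Unique L) where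
    open Delta _≟_ using (Σ-δ; Σ-δ-1)

    Σ-fibre : ∀ {A : Set} (As : List A) (f : A → K) → (∀ {a} → a ∈ As → f a ∈ L) →
      Σ L (λ t → Σ As (λ a → χ (f a ≟ t))) ≡ + length As
    Σ-fibre As f covers =
      trans (Σ-swap L As _)
        (trans (Σ-cong As (λ {a} a∈ → Σ-δ-1 L uL (f a) (covers a∈)))
               (trans (Σ-const As 1ℤ) (ℤP.*-identityʳ _)))

    Σ-fibre-product : ∀ {A B : Set} (As : List A) (Bs : List B) (f : A → K) (g : B → K) →
      (∀ {a} → a ∈ As → f a ∈ L) →
      Σ L (λ t → Σ As (λ a → χ (f a ≟ t)) * Σ Bs (λ b → χ (g b ≟ t)))
        ≡ Σ As (λ a → Σ Bs (λ b → χ (f a ≟ g b)))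
    Σ-fibre-product As Bs f g covers = begin
        Σ L (λ t → Σ As (λ a → χ (f a ≟ t)) * Σ Bs (λ b → χ (g b ≟ t)))
      ≡⟨ Σ-cong′ L (λ t → Σ-mul As Bs _ _) ⟩
        Σ L (λ t → Σ As (λ a → Σ Bs (λ b → χ (f a ≟ t) * χ (g b ≟ t))))
      ≡⟨ Σ-swap L As _ ⟩
        Σ As (λ a → Σ L (λ t → Σ Bs (λ b → χ (f a ≟ t) * χ (g b ≟ t))))
      ≡⟨ Σ-cong As (λ {a} a∈ → trans (Σ-swap L Bs _) (Σ-cong′ Bs (λ b →
           trans (Σ-δ L uL (f a) (λ t → χ (g b ≟ t)) (covers a∈)) (χ-iff (g b ≟ f a) (f a ≟ g b) sym sym)))) ⟩
        Σ As (λ a → Σ Bs (λ b → χ (f a ≟ g b))) ∎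
      where open ≡-Reasoning

    module _ {A B : Set} (As : List A) (Bs : List B) (f : A → B → K) where
      fibre₂ : K → ℤ
      fibre₂ t = Σ As (λ a → Σ Bs (λ b → χ (f a b ≟ t)))

      coincidences : ℤ
      coincidences = Σ As (λ a → Σ As (λ a' → Σ Bs (λ b → Σ Bs (λ b' → χ (f a b ≟ f a' b')))))

      module _ (covers : ∀ {a b} → a ∈ As → b ∈ Bs → f a b ∈ L) where
        Σ-fibre₂ : Σ L fibre₂ ≡ + length As * + length Bs
        Σ-fibre₂ = trans (Σ-swap L As _)
                     (trans (Σ-cong As (λ a∈ → Σ-fibre Bs _ (λ b∈ → covers a∈ b∈))) (Σ-const As _))

        Σ-fibre₂² : Σ L (λ t → fibre₂ t * fibre₂ t) ≡ coincidences
        Σ-fibre₂² =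
          trans (Σ-cong′ L (λ t → Σ-mul As As _ _))
            (trans (Σ-swap L As _) (Σ-cong As (λ a∈ → trans (Σ-swap L As _)
              (Σ-cong′ As (λ a' → Σ-fibre-product Bs Bs _ _ (λ b∈ → covers a∈ b∈))))))

        collision-bound : (+ length As * + length Bs) * (+ length As * + length Bs) ≤ + length L * coincidences
        collision-bound =
          subst₂ _≤_ (cong₂ _*_ Σ-fibre₂ Σ-fibre₂) (cong (+ length L *_) Σ-fibre₂²) (cauchy-schwarz L fibre₂)


module Geometry where

  open import Defs
  open import Data.Nat using (ℕ)
  open import Data.Vec as Vec using (Vec; []; _∷_; zipWith)
  import Data.Vec.Properties as VecP
  open import Data.Product using (_,_)
  open import Data.Sum using (_⊎_; inj₁; inj₂)
  open import Relation.Binary.PropositionalEquality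
  open import Relation.Nullary using (¬_; yes; no)
  open import Algebra.Bundles using (CommutativeRing)
  open import Algebra.Structures using (IsCommutativeRing)
  import Algebra.Properties.Ring as RingProperties

  module FieldGeometry {q : ℕ} (F : FiniteField q) where
    open FiniteField F
    open IsCommutativeRing isCommutativeRing
      using (+-assoc; +-identityˡ; +-identityʳ; -‿inverseˡ; -‿inverseʳ;
             *-assoc; *-comm; *-identityˡ; *-identityʳ; distribˡ; distribʳ; zeroʳ)

    commutativeRing : CommutativeRing _ _
    commutativeRing = record { isCommutativeRing = isCommutativeRing }

    open RingProperties (CommutativeRing.ring commutativeRing)
      using (+-cancelˡ; -‿injective; -‿distribˡ-*; -‿distribʳ-*; -‿involutive; -‿+-comm;
             x∙y⁻¹≈ε⇒x≈y; +-inverseˡ-unique)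
    -- A normaliser for commutative-semiring identities; negated atoms are
    -- passed to it as separate variables.
    open import Algebra.Solver.Ring.NaturalCoefficients.Default
      (CommutativeRing.commutativeSemiring commutativeRing)
    open ≡-Reasoning

    neg-add : ∀ a b → - (a + b) ≡ - a + - b
    neg-add a b = sym (-‿+-comm a b)

    diff-zero : ∀ {a b} → a - b ≡ 0# → a ≡ b
    diff-zero {a} {b} = x∙y⁻¹≈ε⇒x≈y a b

    cancel : ∀ {s a b} → ¬ (s ≡ 0#) → s * a ≡ s * b → a ≡ b
    cancel {s} {a} {b} s≢0 e with inverse s s≢0
    ... | y , sy = begin
        a           ≡⟨ sym (*-identityˡ a) ⟩
        1# * a      ≡⟨ cong (_* a) (trans (sym sy) (*-comm s y)) ⟩
        (y * s) * a ≡⟨ *-assoc y s a ⟩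
        y * (s * a) ≡⟨ cong (y *_) e ⟩
        y * (s * b) ≡⟨ sym (*-assoc y s b) ⟩
        (y * s) * b ≡⟨ cong (_* b) (trans (*-comm y s) sy) ⟩
        1# * b      ≡⟨ *-identityˡ b ⟩
        b           ∎

    zero-product : ∀ {a b} → a * b ≡ 0# → a ≡ 0# ⊎ b ≡ 0#
    zero-product {a} {b} e with a ≟ 0#
    ... | yes a≡0 = inj₁ a≡0
    ... | no a≢0 = inj₂ (cancel a≢0 (trans e (sym (zeroʳ a))))

    difference-of-squares : ∀ s t → (s - t) * (s + t) ≡ (s * s) - (t * t)
    difference-of-squares s t = begin
        (s + - t) * (s + t)
      ≡⟨ distribʳ (s + t) s (- t) ⟩
        s * (s + t) + (- t) * (s + t)
      ≡⟨ cong (s * (s + t) +_) (sym (-‿distribˡ-* t (s + t))) ⟩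
        s * (s + t) + - (t * (s + t))
      ≡⟨ cong₂ _+_ (distribˡ s s t) (trans (cong -_ (trans (distribˡ t s t) (cong (_+ t * t) (*-comm t s))))
                                           (neg-add (s * t) (t * t))) ⟩
        (s * s + s * t) + (- (s * t) + - (t * t))
      ≡⟨ regroup (s * s) (s * t) (- (s * t)) (- (t * t)) ⟩
        s * s + (s * t + - (s * t)) + - (t * t)
      ≡⟨ cong (λ z → s * s + z + - (t * t)) (-‿inverseʳ (s * t)) ⟩
        s * s + 0# + - (t * t)
      ≡⟨ cong (_+ - (t * t)) (+-identityʳ (s * s)) ⟩
        (s * s) - (t * t) ∎
      where
        regroup : ∀ A B C D → (A + B) + (C + D) ≡ A + (B + C) + D
        regroup = solve 4 (λ A B C D → (A :+ B) :+ (C :+ D) := A :+ (B :+ C) :+ D) refl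

    square-roots : ∀ {s t} → s * s ≡ t * t → s ≡ t ⊎ s ≡ - t
    square-roots {s} {t} e
      with zero-product (trans (difference-of-squares s t) (trans (cong (_- (t * t)) e) (-‿inverseʳ (t * t))))
    ... | inj₁ s-t≡0 = inj₁ (diff-zero s-t≡0)
    ... | inj₂ s+t≡0 = inj₂ (+-inverseˡ-unique s t s+t≡0)

    linear-solve : ∀ {a v r c y} → v * y ≡ 1# → a * v + r ≡ c → (c - r) * y ≡ a
    linear-solve {a} {v} {r} {c} {y} vy e = begin
        (c - r) * y           ≡⟨ cong (λ z → (z - r) * y) (sym e) ⟩
        ((a * v + r) - r) * y ≡⟨ cong (_* y) (trans (+-assoc (a * v) r (- r))
                                   (trans (cong (a * v +_) (-‿inverseʳ r)) (+-identityʳ _))) ⟩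
        (a * v) * y           ≡⟨ trans (*-assoc a v y) (trans (cong (a *_) vy) (*-identityʳ a)) ⟩
        a                     ∎

    linear-solve⁻¹ : ∀ {a v r c y} → v * y ≡ 1# → (c - r) * y ≡ a → a * v + r ≡ c
    linear-solve⁻¹ {a} {v} {r} {c} {y} vy refl = begin
        (c - r) * y * v + r ≡⟨ cong (_+ r) (trans (*-assoc _ y v)
                                 (trans (cong ((c - r) *_) (trans (*-comm y v) vy)) (*-identityʳ _))) ⟩
        (c - r) + r         ≡⟨ trans (+-assoc c (- r) r) (trans (cong (c +_) (-‿inverseˡ r)) (+-identityʳ c)) ⟩
        c                   ∎

    dot : ∀ {n} → Vec Carrier n → Vec Carrier n → Carrier
    dot [] [] = 0#
    dot (a ∷ x) (b ∷ y) = a * b + dot x y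

    scale : ∀ {n} → Carrier → Vec Carrier n → Vec Carrier n
    scale s = Vec.map (s *_)

    dot-scale : ∀ {n} s (ξ x : Vec Carrier n) → dot (scale s ξ) x ≡ s * dot ξ x
    dot-scale s [] [] = sym (zeroʳ s)
    dot-scale s (a ∷ ξ) (b ∷ x) = begin
        s * a * b + dot (scale s ξ) x ≡⟨ cong₂ _+_ (*-assoc s a b) (dot-scale s ξ x) ⟩
        s * (a * b) + s * dot ξ x     ≡⟨ sym (distribˡ s _ _) ⟩
        s * (a * b + dot ξ x)         ∎

    dot-sub : ∀ {n} (ξ x y : Vec Carrier n) → dot ξ (zipWith _-_ x y) ≡ dot ξ x - dot ξ y
    dot-sub [] [] [] = sym (-‿inverseʳ 0#)
    dot-sub (a ∷ ξ) (b ∷ x) (c ∷ y) = begin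
        a * (b + - c) + dot ξ (zipWith _-_ x y)
      ≡⟨ cong₂ _+_ (trans (distribˡ a b (- c)) (cong (a * b +_) (sym (-‿distribʳ-* a c)))) (dot-sub ξ x y) ⟩
        (a * b + - (a * c)) + (dot ξ x + - dot ξ y)
      ≡⟨ interchange (a * b) (- (a * c)) (dot ξ x) (- dot ξ y) ⟩
        (a * b + dot ξ x) + (- (a * c) + - dot ξ y)
      ≡⟨ cong ((a * b + dot ξ x) +_) (sym (neg-add (a * c) (dot ξ y))) ⟩
        (a * b + dot ξ x) - (a * c + dot ξ y) ∎
      where
        interchange : ∀ A B C D → (A + B) + (C + D) ≡ (A + C) + (B + D)
        interchange = solve 4 (λ A B C D → (A :+ B) :+ (C :+ D) := (A :+ C) :+ (B :+ D)) refl

    sumSq-scale : ∀ {n} s (x : Vec Carrier n) → sumSq F (scale s x) ≡ (s * s) * sumSq F x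
    sumSq-scale s [] = sym (zeroʳ _)
    sumSq-scale s (a ∷ x) = trans (cong ((s * a) * (s * a) +_) (sumSq-scale s x)) (factor s a (sumSq F x))
      where
        factor : ∀ s a X → (s * a) * (s * a) + (s * s) * X ≡ (s * s) * (a * a + X)
        factor = solve 3 (λ s a X → (s :* a) :* (s :* a) :+ (s :* s) :* X := (s :* s) :* (a :* a :+ X)) refl

    dist-polarisation : ∀ {n} (x y : Vec Carrier n) →
      dist F x y ≡ (sumSq F x + sumSq F y) - (dot x y + dot x y)
    dist-polarisation [] [] = sym (-‿inverseʳ (0# + 0#))
    dist-polarisation (a ∷ x) (b ∷ y) = begin
        (a + - b) * (a + - b) + dist F x y
      ≡⟨ cong ((a + - b) * (a + - b) +_)
              (trans (dist-polarisation x y) (cong ((X + Y) +_) (neg-add (dot x y) (dot x y)))) ⟩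
        (a + - b) * (a + - b) + ((X + Y) + (nZ + nZ))
      ≡⟨ expand a (- b) X Y nZ ⟩
        (a * a + X) + ((- b) * (- b) + Y) + ((a * (- b) + nZ) + (a * (- b) + nZ))
      ≡⟨ cong₂ (λ u v → (a * a + X) + (u + Y) + ((v + nZ) + (v + nZ))) neg-square (sym (-‿distribʳ-* a b)) ⟩
        (a * a + X) + (b * b + Y) + ((- (a * b) + nZ) + (- (a * b) + nZ))
      ≡⟨ cong ((a * a + X) + (b * b + Y) +_)
              (trans (cong₂ _+_ (sym (neg-add (a * b) (dot x y))) (sym (neg-add (a * b) (dot x y))))
                     (sym (neg-add _ _))) ⟩
        ((a * a + X) + (b * b + Y)) - ((a * b + dot x y) + (a * b + dot x y)) ∎
      where
        X Y nZ : Carrier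
        X = sumSq F x
        Y = sumSq F y
        nZ = - dot x y
        neg-square : (- b) * (- b) ≡ b * b
        neg-square = trans (sym (-‿distribˡ-* b (- b)))
                           (trans (cong -_ (sym (-‿distribʳ-* b b))) (-‿involutive (b * b)))
        expand : ∀ a nb X Y nZ → (a + nb) * (a + nb) + ((X + Y) + (nZ + nZ))
               ≡ (a * a + X) + (nb * nb + Y) + ((a * nb + nZ) + (a * nb + nZ))
        expand = solve 5 (λ a nb X Y nZ → (a :+ nb) :* (a :+ nb) :+ ((X :+ Y) :+ (nZ :+ nZ))
                      := (a :* a :+ X) :+ (nb :* nb :+ Y) :+ ((a :* nb :+ nZ) :+ (a :* nb :+ nZ))) refl

    sphere-dist : ∀ {n} (x y : Vec Carrier n) → OnSphere F x → OnSphere F y →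
      dist F x y ≡ (1# + 1#) - (dot x y + dot x y)
    sphere-dist x y sx sy =
      trans (dist-polarisation x y) (cong₂ (λ u v → (u + v) - (dot x y + dot x y)) sx sy)

    module _ {n} (x y x' y' : Vec Carrier n)
             (sx : OnSphere F x) (sy : OnSphere F y) (sx' : OnSphere F x') (sy' : OnSphere F y') where
      dot⇒dist : dot x y ≡ dot x' y' → dist F x y ≡ dist F x' y'
      dot⇒dist e = trans (sphere-dist x y sx sy)
                     (trans (cong (λ z → (1# + 1#) - (z + z)) e) (sym (sphere-dist x' y' sx' sy')))

      dist⇒dot : ¬ (1# + 1# ≡ 0#) → dist F x y ≡ dist F x' y' → dot x y ≡ dot x' y'
      dist⇒dot 2≢0 e = cancel 2≢0 (trans (sym (double _)) (trans doubled (double _)))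
        where
          double : ∀ a → a + a ≡ (1# + 1#) * a
          double a = sym (trans (distribʳ a 1# 1#) (cong₂ _+_ (*-identityˡ a) (*-identityˡ a)))
          doubled : dot x y + dot x y ≡ dot x' y' + dot x' y'
          doubled = -‿injective (+-cancelˡ (1# + 1#) _ _
                      (trans (sym (sphere-dist x y sx sy)) (trans e (sphere-dist x' y' sx' sy'))))

    scale-injective : ∀ {n s} {x y : Vec Carrier n} → ¬ (s ≡ 0#) → scale s x ≡ scale s y → x ≡ y
    scale-injective {x = []} {[]} s≢0 e = refl
    scale-injective {x = a ∷ x} {b ∷ y} s≢0 e =
      cong₂ _∷_ (cancel s≢0 (VecP.∷-injectiveˡ e)) (scale-injective s≢0 (VecP.∷-injectiveʳ e))

    scale-of-sphere : ∀ {n s} {x ξ : Vec Carrier n} → OnSphere F x → scale s x ≡ ξ → s * s ≡ sumSq F ξ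
    scale-of-sphere {s = s} {x} sx refl =
      sym (trans (sumSq-scale s x) (trans (cong ((s * s) *_) sx) (*-identityʳ _)))

    sub-zero⇒≡ : ∀ {n} {x y : Vec Carrier n} → zipWith _-_ x y ≡ Vec.replicate n 0# → x ≡ y
    sub-zero⇒≡ {x = []} {[]} e = refl
    sub-zero⇒≡ {x = a ∷ x} {b ∷ y} e =
      cong₂ _∷_ (diff-zero (VecP.∷-injectiveˡ e)) (sub-zero⇒≡ (VecP.∷-injectiveʳ e))


module Counting where

  open import Defs
  open Sums
  open Geometry
  open import Data.Nat using (ℕ; zero; suc; _^_)
  open import Data.Nat.Divisibility using (_∣_; divides)
  open import Data.Integer as ℤ using (ℤ; +_; _+_; _*_; -_; _-_; _≤_; 0ℤ; 1ℤ)
  import Data.Integer.Properties as ℤP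
  open import Data.Integer.Tactic.RingSolver using (solve-∀)
  open import Data.Vec as Vec using (Vec; []; _∷_; zipWith)
  import Data.Vec.Properties as VecP
  open import Data.List as List using (List; []; _∷_; length; concatMap)
  import Data.List.Properties as ListP
  open import Data.List.Membership.Propositional using (_∈_)
  import Data.List.Membership.Propositional.Properties as MembershipP
  open import Data.List.Relation.Unary.Unique.Propositional using (Unique)
  import Data.List.Relation.Unary.Unique.Propositional.Properties as UniqueP
  open import Data.Fin as Fin using (Fin)
  import Data.Fin.Properties as FinP
  open import Data.Product using (_,_)
  open import Relation.Binary.PropositionalEquality
  open import Relation.Binary.Definitions using (DecidableEquality; tri<; tri≈; tri>)
  open import Relation.Nullary using (¬_; yes; no; Dec)
  open import Data.Empty using (⊥-elim)
  open import Function.Bundles using (Inverse)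
  open import Algebra.Structures using (IsCommutativeRing)

  module FieldCounting {q : ℕ} (F : FiniteField q) where
    open FiniteField F using (Carrier; enum; _≟_; 0#; 1#; inverse; 0≢1; isCommutativeRing)
      renaming (_+_ to _+F_; _*_ to _*F_; -_ to -F_; _-_ to _-F_)
    open IsCommutativeRing isCommutativeRing using (+-assoc; +-identityˡ; +-identityʳ; -‿inverseˡ; -‿inverseʳ; zeroʳ)
    open FieldGeometry F using (dot; dot-sub; diff-zero; sub-zero⇒≡; linear-solve; linear-solve⁻¹)

    _≟V_ : ∀ {n} → DecidableEquality (Vec Carrier n)
    _≟V_ = VecP.≡-dec _≟_

    allF : List Carrier
    allF = List.map (Inverse.to enum) (List.allFin q)

    allF-unique : Unique allF
    allF-unique = UniqueP.map⁺ to-injective (UniqueP.allFin⁺ q)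
      where
        to-injective : ∀ {i j} → Inverse.to enum i ≡ Inverse.to enum j → i ≡ j
        to-injective {i} {j} e = trans (sym (Inverse.strictlyInverseʳ enum i))
                                   (trans (cong (Inverse.from enum) e) (Inverse.strictlyInverseʳ enum j))

    ∈allF : ∀ x → x ∈ allF
    ∈allF x = subst (_∈ allF) (Inverse.strictlyInverseˡ enum x)
                (MembershipP.∈-map⁺ (Inverse.to enum) (MembershipP.∈-allFin _))

    length-allF : length allF ≡ q
    length-allF = trans (ListP.length-map _ (List.allFin q)) (ListP.length-tabulate {n = q} (λ i → i))

    ΣF-const : ∀ c → Σ allF (λ _ → c) ≡ + q * c
    ΣF-const c = trans (Σ-const allF c) (cong (λ n → + n * c) length-allF)

    open Delta _≟_ using (Σ-δ; Σ-δ-1)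

    ΣF-δ : ∀ u g → Σ allF (λ v → χ (u ≟ v) * g v) ≡ g u
    ΣF-δ u g = Σ-δ allF allF-unique u g (∈allF u)

    ΣF-δ-1 : ∀ u → Σ allF (λ v → χ (u ≟ v)) ≡ 1ℤ
    ΣF-δ-1 u = Σ-δ-1 allF allF-unique u (∈allF u)

    ΣF-variance : ∀ (f : Carrier → ℤ) → let S = Σ allF f in
      Σ allF (λ t → (+ q * f t - S) * (+ q * f t - S)) ≡ + q * (+ q * Σ allF (λ t → f t * f t) - S * S)
    ΣF-variance f = subst (λ m → Σ allF (λ t → (+ m * f t - Σ allF f) * (+ m * f t - Σ allF f))
                               ≡ + m * (+ m * Σ allF (λ t → f t * f t) - Σ allF f * Σ allF f))
                          length-allF (variance allF f)

    allV : ∀ n → List (Vec Carrier n)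
    allV zero = [] ∷ []
    allV (suc n) = concatMap (λ a → List.map (a ∷_) (allV n)) allF

    ΣV-suc : ∀ n (f : Vec Carrier (suc n) → ℤ) → Σ (allV (suc n)) f ≡ Σ allF (λ a → Σ (allV n) (λ ξ → f (a ∷ ξ)))
    ΣV-suc n f = trans (Σ-concatMap (λ a → List.map (a ∷_) (allV n)) allF f)
                       (Σ-cong′ allF (λ a → Σ-map (a ∷_) (allV n) f))

    ΣV-const : ∀ n c → Σ (allV n) (λ _ → c) ≡ + (q ^ n) * c
    ΣV-const zero c = trans (ℤP.+-identityʳ c) (sym (ℤP.*-identityˡ c))
    ΣV-const (suc n) c = begin
        Σ (allV (suc n)) (λ _ → c)         ≡⟨ ΣV-suc n _ ⟩
        Σ allF (λ _ → Σ (allV n) (λ _ → c)) ≡⟨ Σ-cong′ allF (λ _ → ΣV-const n c) ⟩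
        Σ allF (λ _ → + (q ^ n) * c)       ≡⟨ ΣF-const _ ⟩
        + q * (+ (q ^ n) * c)              ≡⟨ sym (ℤP.*-assoc (+ q) _ c) ⟩
        + q * + (q ^ n) * c                ≡⟨ cong (_* c) (sym (ℤP.pos-* q (q ^ n))) ⟩
        + (q ^ suc n) * c                  ∎
      where open ≡-Reasoning

    ΣV-δ : ∀ n (u : Vec Carrier n) (g : Vec Carrier n → ℤ) → Σ (allV n) (λ ξ → χ (u ≟V ξ) * g ξ) ≡ g u
    ΣV-δ zero [] g = trans (ℤP.+-identityʳ _) (trans (cong (_* g []) (χ-yes ([] ≟V []) refl)) (ℤP.*-identityˡ _))
    ΣV-δ (suc n) (u₀ ∷ u) g = begin
        Σ (allV (suc n)) (λ ξ → χ ((u₀ ∷ u) ≟V ξ) * g ξ)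
      ≡⟨ ΣV-suc n _ ⟩
        Σ allF (λ a → Σ (allV n) (λ ξ → χ ((u₀ ∷ u) ≟V (a ∷ ξ)) * g (a ∷ ξ)))
      ≡⟨ Σ-cong′ allF (λ a → trans (Σ-cong′ (allV n) (λ ξ →
           trans (cong (_* g (a ∷ ξ)) (χ-cons a ξ)) (ℤP.*-assoc (χ (u₀ ≟ a)) _ _)))
           (Σ-*ˡ (allV n) (χ (u₀ ≟ a)) _)) ⟩
        Σ allF (λ a → χ (u₀ ≟ a) * Σ (allV n) (λ ξ → χ (u ≟V ξ) * g (a ∷ ξ)))
      ≡⟨ Σ-cong′ allF (λ a → cong (χ (u₀ ≟ a) *_) (ΣV-δ n u (λ ξ → g (a ∷ ξ)))) ⟩
        Σ allF (λ a → χ (u₀ ≟ a) * g (a ∷ u))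
      ≡⟨ ΣF-δ u₀ (λ a → g (a ∷ u)) ⟩
        g (u₀ ∷ u) ∎
      where
        open ≡-Reasoning
        χ-cons : ∀ a ξ → χ ((u₀ ∷ u) ≟V (a ∷ ξ)) ≡ χ (u₀ ≟ a) * χ (u ≟V ξ)
        χ-cons a ξ = split ((u₀ ∷ u) ≟V (a ∷ ξ)) (u₀ ≟ a) (u ≟V ξ)
          where
            split : (d : Dec ((u₀ ∷ u) ≡ (a ∷ ξ))) (d₀ : Dec (u₀ ≡ a)) (d' : Dec (u ≡ ξ)) → χ d ≡ χ d₀ * χ d'
            split d (yes p) (yes p') = χ-yes d (cong₂ _∷_ p p')
            split d (yes _) (no ¬p') = χ-no d (λ e → ¬p' (VecP.∷-injectiveʳ e))
            split d (no ¬p) d'       = χ-no d (λ e → ¬p (VecP.∷-injectiveˡ e))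

    affine-hits-once : ∀ v r c → ¬ (v ≡ 0#) → Σ allF (λ a → χ ((a *F v +F r) ≟ c)) ≡ 1ℤ
    affine-hits-once v r c v≢0 with inverse v v≢0
    ... | y , vy = trans (Σ-cong′ allF (λ a →
                     χ-iff ((a *F v +F r) ≟ c) (((c -F r) *F y) ≟ a) (linear-solve vy) (linear-solve⁻¹ vy)))
                   (ΣF-δ-1 ((c -F r) *F y))

    hyperplane-count : ∀ n (v : Vec Carrier (suc n)) → ¬ (v ≡ Vec.replicate (suc n) 0#) → ∀ c →
      Σ (allV (suc n)) (λ ξ → χ (dot ξ v ≟ c)) ≡ + (q ^ n)
    hyperplane-count n (v₀ ∷ v) v≢0 c with v₀ ≟ 0#
    ... | no v₀≢0 =
      trans (ΣV-suc n _)
        (trans (Σ-swap allF (allV n) _)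
          (trans (Σ-cong′ (allV n) (λ ξ → affine-hits-once v₀ (dot ξ v) c v₀≢0))
                 (trans (ΣV-const n 1ℤ) (ℤP.*-identityʳ _))))
    hyperplane-count zero (v₀ ∷ []) v≢0 c | yes v₀≡0 = ⊥-elim (v≢0 (cong (_∷ []) v₀≡0))
    hyperplane-count (suc m) (v₀ ∷ v) v≢0 c | yes v₀≡0 =
      trans (ΣV-suc (suc m) _)
        (trans (Σ-cong′ allF (λ a → trans (Σ-cong′ (allV (suc m)) (λ ξ → cong (λ z → χ (z ≟ c)) (first-vanishes a ξ)))
                                          (hyperplane-count m v (λ e → v≢0 (cong₂ _∷_ v₀≡0 e)) c)))
               (trans (ΣF-const _) (sym (ℤP.pos-* q (q ^ m)))))
      where
        first-vanishes : ∀ a ξ → a *F v₀ +F dot ξ v ≡ dot ξ v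
        first-vanishes a ξ = trans (cong (λ z → a *F z +F dot ξ v) v₀≡0)
                               (trans (cong (_+F dot ξ v) (zeroʳ a)) (+-identityˡ _))

    -- Σ_ξ [ξ·x = ξ·x'] = q^n + [x = x'] (q^{n+1} - q^n) in F^{n+1}: for x ≠ x'
    -- this is a hyperplane count for the normal vector x - x'.
    dot-agreements : ∀ n (x x' : Vec Carrier (suc n)) →
      Σ (allV (suc n)) (λ ξ → χ (dot ξ x ≟ dot ξ x')) ≡ + (q ^ n) + χ (x ≟V x') * (+ (q ^ suc n) - + (q ^ n))
    dot-agreements n x x' with x ≟V x'
    ... | yes refl =
      trans (Σ-cong′ (allV (suc n)) (λ ξ → χ-yes (dot ξ x ≟ dot ξ x) refl))
        (trans (trans (ΣV-const (suc n) 1ℤ) (ℤP.*-identityʳ _)) (rearrange (+ (q ^ suc n)) (+ (q ^ n))))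
      where
        rearrange : ∀ a b → a ≡ b + 1ℤ * (a - b)
        rearrange = solve-∀
    ... | no x≢x' =
      trans (Σ-cong′ (allV (suc n)) (λ ξ → χ-iff (dot ξ x ≟ dot ξ x') (dot ξ (zipWith _-F_ x x') ≟ 0#)
              (λ e → trans (dot-sub ξ x x') (trans (cong (_-F dot ξ x') e) (-‿inverseʳ _)))
              (λ e → diff-zero (trans (sym (dot-sub ξ x x')) e))))
        (trans (hyperplane-count n (zipWith _-F_ x x') (λ e → x≢x' (sub-zero⇒≡ e)) 0#)
               (sym (trans (cong (λ z → + (q ^ n) + z) (ℤP.*-zeroˡ (+ (q ^ suc n) - + (q ^ n)))) (ℤP.+-identityʳ _))))

    -- If 1 + 1 = 0 then x ↦ x + 1 is a fixed-point-free involution of F, so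
    -- its orbits pair up the elements of F and q is even.
    module CharacteristicTwo (2≡0 : 1# +F 1# ≡ 0#) where
      shift : Carrier → Carrier
      shift x = x +F 1#

      shift-involutive : ∀ x → shift (shift x) ≡ x
      shift-involutive x = trans (+-assoc x 1# 1#) (trans (cong (x +F_) 2≡0) (+-identityʳ x))

      shift-no-fixpoint : ∀ x → ¬ (shift x ≡ x)
      shift-no-fixpoint x e = 0≢1 (sym (begin
          1#                   ≡⟨ sym (+-identityˡ 1#) ⟩
          0# +F 1#             ≡⟨ cong (_+F 1#) (sym (-‿inverseˡ x)) ⟩
          (-F x +F x) +F 1#    ≡⟨ +-assoc (-F x) x 1# ⟩
          -F x +F shift x      ≡⟨ cong (-F x +F_) e ⟩
          -F x +F x            ≡⟨ -‿inverseˡ x ⟩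
          0#                   ∎))
        where open ≡-Reasoning

      -- Each orbit {x , x + 1} has exactly one "first" element, in the order
      -- transported from Fin q.
      index : Carrier → Fin q
      index = Inverse.from enum

      first? : ∀ x → Dec (index x Fin.< index (shift x))
      first? x = index x FinP.<? index (shift x)

      one-first-per-orbit : ∀ x → χ (first? x) + χ (first? (shift x)) ≡ 1ℤ
      one-first-per-orbit x with FinP.<-cmp (index x) (index (shift x))
      ... | tri< x<sx _ _ =
        cong₂ _+_ (χ-yes (first? x) x<sx)
                  (χ-no (first? (shift x)) (λ sx<x → FinP.<-asym x<sx
                    (subst (index (shift x) Fin.<_) (cong index (shift-involutive x)) sx<x)))
      ... | tri≈ _ x≡sx _ =
        ⊥-elim (shift-no-fixpoint x (sym (trans (sym (Inverse.strictlyInverseˡ enum x))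
                                           (trans (cong (Inverse.to enum) x≡sx) (Inverse.strictlyInverseˡ enum (shift x))))))
      ... | tri> _ _ sx<x =
        cong₂ _+_ (χ-no (first? x) (λ x<sx → FinP.<-asym x<sx sx<x))
                  (χ-yes (first? (shift x)) (subst (index (shift x) Fin.<_) (sym (cong index (shift-involutive x))) sx<x))

      Σ-shift : ∀ (f : Carrier → ℤ) → Σ allF (λ x → f (shift x)) ≡ Σ allF f
      Σ-shift f = begin
          Σ allF (λ x → f (shift x))
        ≡⟨ Σ-cong′ allF (λ x → sym (ΣF-δ (shift x) f)) ⟩
          Σ allF (λ x → Σ allF (λ y → χ (shift x ≟ y) * f y))
        ≡⟨ Σ-swap allF allF _ ⟩
          Σ allF (λ y → Σ allF (λ x → χ (shift x ≟ y) * f y))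
        ≡⟨ Σ-cong′ allF (λ y → trans (Σ-*ʳ allF (f y) (λ x → χ (shift x ≟ y))) (cong (_* f y) (preimage y))) ⟩
          Σ allF (λ y → 1ℤ * f y)
        ≡⟨ Σ-cong′ allF (λ y → ℤP.*-identityˡ (f y)) ⟩
          Σ allF f ∎
        where
          open ≡-Reasoning
          preimage : ∀ y → Σ allF (λ x → χ (shift x ≟ y)) ≡ 1ℤ
          preimage y = trans (Σ-cong′ allF (λ x → χ-iff (shift x ≟ y) (shift y ≟ x)
                                 (λ e → trans (cong shift (sym e)) (shift-involutive x))
                                 (λ e → trans (cong shift (sym e)) (shift-involutive y))))
                             (ΣF-δ-1 (shift y))

      q-even : 2 ∣ q
      q-even = from-sum (Σ allF (λ x → χ (first? x))) refl
        where
          S : ℤ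
          S = Σ allF (λ x → χ (first? x))
          q≡S+S : + q ≡ S + S
          q≡S+S = begin
              + q                                                   ≡⟨ sym (trans (ΣF-const 1ℤ) (ℤP.*-identityʳ (+ q))) ⟩
              Σ allF (λ _ → 1ℤ)                                     ≡⟨ Σ-cong′ allF (λ x → sym (one-first-per-orbit x)) ⟩
              Σ allF (λ x → χ (first? x) + χ (first? (shift x)))    ≡⟨ Σ-+ allF _ _ ⟩
              S + Σ allF (λ x → χ (first? (shift x)))               ≡⟨ cong (λ z → S + z) (Σ-shift (λ x → χ (first? x))) ⟩
              S + S                                                 ∎
            where open ≡-Reasoning
          from-sum : ∀ s → S ≡ s → 2 ∣ q
          from-sum (+ k) S≡k =
            divides k (ℤP.+-injective (trans q≡S+S (trans (cong₂ _+_ S≡k S≡k) (trans (double (+ k)) (sym (ℤP.pos-* k 2))))))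
            where
              double : ∀ a → a + a ≡ a * + 2
              double = solve-∀
          from-sum ℤ.-[1+ k ] S≡k with subst (0ℤ ≤_) S≡k (Σ-nonneg allF (λ {x} _ → χ-nonneg (first? x)))
          ... | ()

    odd⇒2≢0 : ¬ (2 ∣ q) → ¬ (1# +F 1# ≡ 0#)
    odd⇒2≢0 odd 2≡0 = odd (CharacteristicTwo.q-even 2≡0)


module Dilation where

  open import Defs
  open Sums
  open Geometry
  open Counting
  open import Data.Nat as ℕ using (ℕ)
  open import Data.Integer as ℤ using (ℤ; +_; _+_; _*_; -_; _-_; _≤_; 0ℤ; 1ℤ; +≤+)
  import Data.Integer.Properties as ℤP
  open import Data.Vec using (Vec)
  open import Data.List using (List)
  open import Data.List.Membership.Propositional using (_∈_)
  open import Data.List.Relation.Unary.Unique.Propositional using (Unique)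
  open import Data.List.Relation.Unary.All as All using (All)
  import Data.List.Relation.Unary.Any as Any
  open import Data.Product using (_,_)
  open import Data.Sum using (inj₁; inj₂)
  open import Relation.Binary.PropositionalEquality
  open import Relation.Nullary using (¬_; yes; no)

  -- Each vector ξ arises as s x (s ≠ 0, x ∈ E) for at most two
  -- pairs, because s² = ‖ξ‖ and x = s⁻¹ ξ; hence
  --   (q - 1) Σ_{x ∈ E} W x = Σ_{s ≠ 0} Σ_{x ∈ E} W (s x) ≤ 2 Σ_{ξ ∈ F^n} W ξ.
  module DilationAverage {q : ℕ} (F : FiniteField q) {n : ℕ}
      (E : List (Vec (FiniteField.Carrier F) n)) (uE : Unique E) (onSphere : All (OnSphere F) E)
      (W : Vec (FiniteField.Carrier F) n → ℤ) (W≥0 : ∀ ξ → 0ℤ ≤ W ξ)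
      (W-invariant : ∀ {s} ξ → ¬ (s ≡ FiniteField.0# F) → W (FieldGeometry.scale F s ξ) ≡ W ξ) where
    open FiniteField F using (Carrier; _≟_; 0#) renaming (_*_ to _*F_; -_ to -F_)
    open FieldGeometry F using (scale; scale-injective; scale-of-sphere; square-roots)
    open FieldCounting F
    open Delta (_≟V_ {n}) using (injective-hits≤1)

    nonzero : Carrier → ℤ
    nonzero s = 1ℤ - χ (s ≟ 0#)

    Σ-nonzero : Σ allF nonzero ≡ + q - 1ℤ
    Σ-nonzero = trans (Σ-+ allF _ _) (cong₂ _+_ (trans (ΣF-const 1ℤ) (ℤP.*-identityʳ (+ q)))
                  (trans (Σ-neg allF _) (cong -_ (trans (Σ-cong′ allF (λ s → χ-iff (s ≟ 0#) (0# ≟ s) sym sym)) (ΣF-δ-1 0#)))))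

    Σ-dilations : Σ allF (λ s → nonzero s * Σ E (λ x → W (scale s x))) ≡ (+ q - 1ℤ) * Σ E W
    Σ-dilations = trans (Σ-cong′ allF invariant) (trans (Σ-*ʳ allF (Σ E W) nonzero) (cong (_* Σ E W) Σ-nonzero))
      where
        invariant : ∀ s → nonzero s * Σ E (λ x → W (scale s x)) ≡ nonzero s * Σ E W
        invariant s with s ≟ 0#
        ... | yes _ = refl
        ... | no s≢0 = cong ((1ℤ - 0ℤ) *_) (Σ-cong′ E (λ x → W-invariant x s≢0))

    multiplicity : Vec Carrier n → ℤ
    multiplicity ξ = Σ allF (λ s → nonzero s * Σ E (λ x → χ (scale s x ≟V ξ)))

    Σ-dilations-by-target : Σ allF (λ s → nonzero s * Σ E (λ x → W (scale s x))) ≡ Σ (allV n) (λ ξ → multiplicity ξ * W ξ)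
    Σ-dilations-by-target = begin
        Σ allF (λ s → nonzero s * Σ E (λ x → W (scale s x)))
      ≡⟨ Σ-cong′ allF (λ s → cong (nonzero s *_) (Σ-cong′ E (λ x → sym (ΣV-δ n (scale s x) W)))) ⟩
        Σ allF (λ s → nonzero s * Σ E (λ x → Σ (allV n) (λ ξ → χ (scale s x ≟V ξ) * W ξ)))
      ≡⟨ Σ-cong′ allF (λ s → trans (cong (nonzero s *_) (trans (Σ-swap E (allV n) _) (Σ-cong′ (allV n) (λ ξ → Σ-*ʳ E (W ξ) _))))
                                   (sym (Σ-*ˡ (allV n) (nonzero s) _))) ⟩
        Σ allF (λ s → Σ (allV n) (λ ξ → nonzero s * (Σ E (λ x → χ (scale s x ≟V ξ)) * W ξ)))
      ≡⟨ Σ-swap allF (allV n) _ ⟩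
        Σ (allV n) (λ ξ → Σ allF (λ s → nonzero s * (Σ E (λ x → χ (scale s x ≟V ξ)) * W ξ)))
      ≡⟨ Σ-cong′ (allV n) (λ ξ → trans (Σ-cong′ allF (λ s → sym (ℤP.*-assoc (nonzero s) _ (W ξ)))) (Σ-*ʳ allF (W ξ) _)) ⟩
        Σ (allV n) (λ ξ → multiplicity ξ * W ξ) ∎
      where open ≡-Reasoning

    multiplicity-term : ∀ ξ s → nonzero s * Σ E (λ x → χ (scale s x ≟V ξ)) ≤ χ ((s *F s) ≟ sumSq F ξ)
    multiplicity-term ξ s with s ≟ 0#
    ... | yes _ = χ-nonneg _
    ... | no s≢0 with (s *F s) ≟ sumSq F ξ
    ...   | yes _ = subst (_≤ 1ℤ) (sym (ℤP.*-identityˡ _)) (injective-hits≤1 E uE (scale s) (scale-injective s≢0) ξ)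
    ...   | no s²≢‖ξ‖ = ℤP.≤-reflexive (trans (ℤP.*-identityˡ _) (Σ-0 E (λ {x} x∈ →
                          χ-no (scale s x ≟V ξ) (λ e → s²≢‖ξ‖ (scale-of-sphere (All.lookup onSphere x∈) e)))))

    square-root-count : ∀ a → Σ allF (λ s → χ ((s *F s) ≟ a)) ≤ + 2
    square-root-count a with Any.any? (λ s → (s *F s) ≟ a) allF
    ... | no no-root = ℤP.≤-trans (ℤP.≤-reflexive (Σ-0 allF (λ {s} s∈ →
                         χ-no ((s *F s) ≟ a) (λ e → no-root (Any.map (λ { refl → e }) s∈))))) (+≤+ ℕ.z≤n)
    ... | yes some-root with Any.satisfied some-root
    ...   | r , r²≡a = ℤP.≤-trans (Σ-mono allF ±r)
                         (ℤP.≤-reflexive (trans (Σ-+ allF _ _) (cong₂ _+_ (ΣF-δ-1 r) (ΣF-δ-1 (-F r)))))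
      where
        ±r : ∀ {s} → s ∈ allF → χ ((s *F s) ≟ a) ≤ χ (r ≟ s) + χ ((-F r) ≟ s)
        ±r {s} _ with (s *F s) ≟ a
        ... | no _ = ℤP.+-mono-≤ (χ-nonneg (r ≟ s)) (χ-nonneg ((-F r) ≟ s))
        ... | yes s²≡a with square-roots (trans s²≡a (sym r²≡a))
        ...   | inj₁ s≡r = ℤP.+-mono-≤ (ℤP.≤-reflexive (sym (χ-yes (r ≟ s) (sym s≡r)))) (χ-nonneg ((-F r) ≟ s))
        ...   | inj₂ s≡-r = subst (_≤ χ (r ≟ s) + χ ((-F r) ≟ s)) (ℤP.+-identityˡ 1ℤ)
                              (ℤP.+-mono-≤ (χ-nonneg (r ≟ s)) (ℤP.≤-reflexive (sym (χ-yes ((-F r) ≟ s) (sym s≡-r)))))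

    multiplicity≤2 : ∀ ξ → multiplicity ξ ≤ + 2
    multiplicity≤2 ξ = ℤP.≤-trans (Σ-mono allF (λ {s} _ → multiplicity-term ξ s)) (square-root-count (sumSq F ξ))

    dilation-average : (+ q - 1ℤ) * Σ E W ≤ + 2 * Σ (allV n) W
    dilation-average = begin
        (+ q - 1ℤ) * Σ E W                     ≡⟨ trans (sym Σ-dilations) Σ-dilations-by-target ⟩
        Σ (allV n) (λ ξ → multiplicity ξ * W ξ) ≤⟨ Σ-mono (allV n) (λ {ξ} _ →
                                                    ℤP.*-monoʳ-≤-nonNeg (W ξ) {{ℤ.nonNegative (W≥0 ξ)}} (multiplicity≤2 ξ)) ⟩
        Σ (allV n) (λ ξ → + 2 * W ξ)          ≡⟨ Σ-*ˡ (allV n) (+ 2) W ⟩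
        + 2 * Σ (allV n) W                    ∎
      where open ℤP.≤-Reasoning


module Estimates where

  open import Defs
  open Sums
  open Geometry
  open Counting
  open Dilation
  open import Data.Nat as ℕ using (ℕ; zero; suc; _^_)
  import Data.Nat.Properties as ℕP
  open import Data.Integer as ℤ using (ℤ; +_; _+_; _*_; -_; _-_; _≤_; 0ℤ; 1ℤ)
  import Data.Integer.Properties as ℤP
  open import Data.Integer.Tactic.RingSolver using (solve-∀)
  open import Data.Vec using (Vec)
  open import Data.List as List using (List; length; concatMap)
  open import Data.List.Membership.Propositional using (_∈_)
  import Data.List.Membership.Propositional.Properties as MembershipP
  open import Data.List.Relation.Unary.Unique.Propositional using (Unique)
  import Data.List.Relation.Unary.Unique.DecPropositional.Properties as DecUniqueP
  open import Data.List.Relation.Unary.All as All using (All)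
  import Data.List.Relation.Unary.Any as Any
  open import Relation.Binary.PropositionalEquality
  open import Relation.Nullary using (¬_)

  module QuadrupleCount {q : ℕ} (F : FiniteField q) (n : ℕ)
      (E : List (Vec (FiniteField.Carrier F) (suc n))) (uE : Unique E) (onSphere : All (OnSphere F) E) where
    open FiniteField F using (Carrier; _≟_; 0#; 1#) renaming (_+_ to _+F_; _*_ to _*F_)
    open FieldGeometry F using (dot; dot-scale; scale; cancel; dot⇒dist; dist⇒dot)
    open FieldCounting F
    open Fibres _≟_ allF allF-unique
    open Delta (_≟V_ {suc n}) using (Σ-δ-1)

    N : ℤ
    N = + length E

    V : List (Vec Carrier (suc n))
    V = allV (suc n)

    H : Vec Carrier (suc n) → Carrier → ℤ
    H ξ t = Σ E (λ y → χ (dot ξ y ≟ t))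

    P : Vec Carrier (suc n) → ℤ
    P ξ = Σ E (λ x → Σ E (λ x' → χ (dot ξ x ≟ dot ξ x')))

    -- W ξ = q P ξ - N² measures how far t ↦ H ξ t is from uniform.
    W : Vec Carrier (suc n) → ℤ
    W ξ = + q * P ξ - N * N

    ΣH : ∀ ξ → Σ allF (H ξ) ≡ N
    ΣH ξ = Σ-fibre E (dot ξ) (λ _ → ∈allF _)

    ΣH² : ∀ ξ → Σ allF (λ t → H ξ t * H ξ t) ≡ P ξ
    ΣH² ξ = Σ-fibre-product E E (dot ξ) (dot ξ) (λ _ → ∈allF _)

    W≥0 : ∀ ξ → 0ℤ ≤ W ξ
    W≥0 ξ = ℤP.i≤j⇒0≤j-i (subst₂ _≤_ (cong₂ _*_ (ΣH ξ) (ΣH ξ)) (cong₂ _*_ (cong +_ length-allF) (ΣH² ξ))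
                                     (cauchy-schwarz allF (H ξ)))

    -- ξ and s ξ (s ≠ 0) induce the same partition of E by dot product.
    W-invariant : ∀ {s} ξ → ¬ (s ≡ 0#) → W (scale s ξ) ≡ W ξ
    W-invariant {s} ξ s≢0 = cong (λ p → + q * p - N * N) (Σ-cong′ E (λ x → Σ-cong′ E (λ x' → χ-iff _ _
        (λ e → cancel s≢0 (trans (sym (dot-scale s ξ x)) (trans e (dot-scale s ξ x'))))
        (λ e → trans (dot-scale s ξ x) (trans (cong (s *F_) e) (sym (dot-scale s ξ x')))))))

    -- Σ_ξ P ξ = N (N q^n + (q^(n+1) - q^n)): the pairs x ≠ x' agree on a
    -- hyperplane's worth of ξ, the diagonal pairs on all of F^(n+1).
    ΣP : Σ V P ≡ N * (N * + (q ^ n) + 1ℤ * (+ (q ^ suc n) - + (q ^ n)))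
    ΣP = begin
        Σ V (λ ξ → Σ E (λ x → Σ E (λ x' → χ (dot ξ x ≟ dot ξ x'))))
      ≡⟨ trans (Σ-swap V E _) (Σ-cong′ E (λ x → Σ-swap V E _)) ⟩
        Σ E (λ x → Σ E (λ x' → Σ V (λ ξ → χ (dot ξ x ≟ dot ξ x'))))
      ≡⟨ Σ-cong′ E (λ x → Σ-cong′ E (λ x' → dot-agreements n x x')) ⟩
        Σ E (λ x → Σ E (λ x' → + (q ^ n) + χ (x ≟V x') * K))
      ≡⟨ Σ-cong E (λ {x} x∈ → trans (Σ-+ E _ _) (cong₂ _+_ (Σ-const E _)
                                (trans (Σ-*ʳ E K _) (cong (_* K) (Σ-δ-1 E uE x x∈))))) ⟩
        Σ E (λ x → N * + (q ^ n) + 1ℤ * K)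
      ≡⟨ Σ-const E _ ⟩
        N * (N * + (q ^ n) + 1ℤ * K) ∎
      where
        open ≡-Reasoning
        K : ℤ
        K = + (q ^ suc n) - + (q ^ n)

    ΣW : Σ V W ≡ N * (+ q - 1ℤ) * + (q ^ suc n)
    ΣW = begin
        Σ V (λ ξ → + q * P ξ + - (N * N))
      ≡⟨ Σ-+ V _ _ ⟩
        Σ V (λ ξ → + q * P ξ) + Σ V (λ _ → - (N * N))
      ≡⟨ cong₂ _+_ (trans (Σ-*ˡ V (+ q) P) (cong (+ q *_) ΣP)) (ΣV-const (suc n) _) ⟩
        + q * (N * (N * + (q ^ n) + 1ℤ * (+ (q ^ suc n) - + (q ^ n)))) + + (q ^ suc n) * - (N * N)
      ≡⟨ cong (λ z → + q * (N * (N * + (q ^ n) + 1ℤ * (z - + (q ^ n)))) + z * - (N * N)) (ℤP.pos-* q (q ^ n)) ⟩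
        + q * (N * (N * + (q ^ n) + 1ℤ * (+ q * + (q ^ n) - + (q ^ n)))) + + q * + (q ^ n) * - (N * N)
      ≡⟨ simplify N (+ q) (+ (q ^ n)) ⟩
        N * (+ q - 1ℤ) * (+ q * + (q ^ n))
      ≡⟨ cong (N * (+ q - 1ℤ) *_) (sym (ℤP.pos-* q (q ^ n))) ⟩
        N * (+ q - 1ℤ) * + (q ^ suc n) ∎
      where
        open ≡-Reasoning
        simplify : ∀ N q M → q * (N * (N * M + 1ℤ * (q * M - M))) + q * M * - (N * N) ≡ N * (q - 1ℤ) * (q * M)
        simplify = solve-∀

    ΣE-W-bound : 1 ℕ.< q → Σ E W ≤ + 2 * N * + (q ^ suc n)
    ΣE-W-bound 1<q = ℤP.*-cancelˡ-≤-pos (Σ E W) (+ 2 * N * + (q ^ suc n)) (+ q - 1ℤ) {{q-1>0 q 1<q}}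
      (begin
        (+ q - 1ℤ) * Σ E W                   ≤⟨ DilationAverage.dilation-average F E uE onSphere W W≥0 W-invariant ⟩
        + 2 * Σ V W                          ≡⟨ cong (+ 2 *_) ΣW ⟩
        + 2 * (N * (+ q - 1ℤ) * + (q ^ suc n)) ≡⟨ reorder N (+ q - 1ℤ) (+ (q ^ suc n)) ⟩
        (+ q - 1ℤ) * (+ 2 * N * + (q ^ suc n)) ∎)
      where
        open ℤP.≤-Reasoning
        reorder : ∀ N r M → + 2 * (N * r * M) ≡ r * (+ 2 * N * M)
        reorder = solve-∀
        q-1>0 : ∀ k → 1 ℕ.< k → ℤ.Positive (+ k - 1ℤ)
        q-1>0 (suc (suc k)) _ = _
        q-1>0 (suc zero) (ℕ.s≤s ())

    Q : ℤ
    Q = coincidences E E dot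

    ν : Carrier → ℤ
    ν = fibre₂ E E dot

    -- G x t = q H x t - N, so that Σ_x G x t = q ν t - N² and
    -- Σ_t (G x t)² = q W x.
    G : Vec Carrier (suc n) → Carrier → ℤ
    G x t = + q * H x t - N

    ΣE-G : ∀ t → Σ E (λ x → G x t) ≡ + q * ν t - N * N
    ΣE-G t = trans (Σ-+ E _ _) (trans (cong₂ _+_ (Σ-*ˡ E (+ q) (λ x → H x t)) (Σ-const E (- N)))
                                      (cong (λ z → + q * ν t + z) (sym (ℤP.neg-distribʳ-* N N))))

    ΣF-G² : ∀ x → Σ allF (λ t → G x t * G x t) ≡ + q * W x
    ΣF-G² x = begin
        Σ allF (λ t → G x t * G x t)
      ≡⟨ Σ-cong′ allF (λ t → cong (λ m → (+ q * H x t - m) * (+ q * H x t - m)) (sym (ΣH x))) ⟩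
        Σ allF (λ t → (+ q * H x t - Σ allF (H x)) * (+ q * H x t - Σ allF (H x)))
      ≡⟨ ΣF-variance (H x) ⟩
        + q * (+ q * Σ allF (λ t → H x t * H x t) - Σ allF (H x) * Σ allF (H x))
      ≡⟨ cong₂ (λ a b → + q * (+ q * a - b * b)) (ΣH² x) (ΣH x) ⟩
        + q * W x ∎
      where open ≡-Reasoning

    quadruple-excess : 0 ℕ.< q → + q * Q - (N * N) * (N * N) ≤ N * Σ E W
    quadruple-excess 0<q = ℤP.*-cancelˡ-≤-pos _ _ (+ q) {{ℤ.positive (ℤ.+<+ 0<q)}} (begin
        + q * (+ q * Q - (N * N) * (N * N))
      ≡⟨ sym (trans (ΣF-variance ν)
               (cong₂ (λ a b → + q * (+ q * a - b * b)) (Σ-fibre₂² E E dot covers) (Σ-fibre₂ E E dot covers))) ⟩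
        Σ allF (λ t → (+ q * ν t - Σ allF ν) * (+ q * ν t - Σ allF ν))
      ≡⟨ Σ-cong′ allF (λ t → cong (λ m → (+ q * ν t - m) * (+ q * ν t - m)) (Σ-fibre₂ E E dot covers)) ⟩
        Σ allF (λ t → (+ q * ν t - N * N) * (+ q * ν t - N * N))
      ≡⟨ Σ-cong′ allF (λ t → sym (cong₂ _*_ (ΣE-G t) (ΣE-G t))) ⟩
        Σ allF (λ t → Σ E (λ x → G x t) * Σ E (λ x → G x t))
      ≤⟨ Σ-mono allF (λ {t} _ → cauchy-schwarz E (λ x → G x t)) ⟩
        Σ allF (λ t → N * Σ E (λ x → G x t * G x t))
      ≡⟨ trans (Σ-*ˡ allF N _) (cong (N *_) (trans (Σ-swap allF E _) (trans (Σ-cong′ E ΣF-G²) (Σ-*ˡ E (+ q) W)))) ⟩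
        N * (+ q * Σ E W)
      ≡⟨ ℤP.*-comm N (+ q * Σ E W) ⟩
        + q * Σ E W * N
      ≡⟨ ℤP.*-assoc (+ q) (Σ E W) N ⟩
        + q * (Σ E W * N)
      ≡⟨ cong (+ q *_) (ℤP.*-comm (Σ E W) N) ⟩
        + q * (N * Σ E W) ∎)
      where
        open ℤP.≤-Reasoning
        covers : ∀ {x y} → x ∈ E → y ∈ E → dot x y ∈ allF
        covers _ _ = ∈allF _

    dot-energy-bound : 1 ℕ.< q → + q * Q - (N * N) * (N * N) ≤ + 2 * (N * N) * + (q ^ suc n)
    dot-energy-bound 1<q = begin
        + q * Q - (N * N) * (N * N) ≤⟨ quadruple-excess (ℕP.<-trans (ℕ.s≤s ℕ.z≤n) 1<q) ⟩
        N * Σ E W                   ≤⟨ ℤP.*-monoˡ-≤-nonNeg N (ΣE-W-bound 1<q) ⟩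
        N * (+ 2 * N * + (q ^ suc n)) ≡⟨ regroup N (+ (q ^ suc n)) ⟩
        + 2 * (N * N) * + (q ^ suc n) ∎
      where
        open ℤP.≤-Reasoning
        regroup : ∀ N M → N * (+ 2 * N * M) ≡ + 2 * (N * N) * M
        regroup = solve-∀

    distances : List Carrier
    distances = concatMap (λ x → List.map (λ y → dist F x y) E) E

    Δ : List Carrier
    Δ = List.deduplicate _≟_ distances

    ∈Δ : ∀ {x y} → x ∈ E → y ∈ E → dist F x y ∈ Δ
    ∈Δ {x} {y} x∈ y∈ = MembershipP.∈-deduplicate⁺ _≟_ (MembershipP.∈-concatMap⁺ (λ x → List.map (λ y → dist F x y) E)
                         (Any.map (λ { refl → MembershipP.∈-map⁺ (λ y → dist F x y) y∈ }) x∈))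

    distance-coincidences : ¬ (1# +F 1# ≡ 0#) → coincidences E E (dist F) ≡ Q
    distance-coincidences 2≢0 =
      Σ-cong E (λ {x} x∈ → Σ-cong E (λ {x'} x'∈ → Σ-cong E (λ {y} y∈ → Σ-cong E (λ {y'} y'∈ →
        let on = All.lookup onSphere in
        χ-iff _ _ (dist⇒dot x y x' y' (on x∈) (on y∈) (on x'∈) (on y'∈) 2≢0)
                  (dot⇒dist x y x' y' (on x∈) (on y∈) (on x'∈) (on y'∈))))))

    distance-collisions : ¬ (1# +F 1# ≡ 0#) → (N * N) * (N * N) ≤ + distanceSetSize F E * Q
    distance-collisions 2≢0 =
      subst (λ c → (N * N) * (N * N) ≤ + length Δ * c) (distance-coincidences 2≢0)
        (Fibres.collision-bound _≟_ Δ (DecUniqueP.deduplicate-! _≟_ distances) E E (dist F) ∈Δ)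

-- The main development; its imports come after the sections above so that
-- the ℕ, ℤ and field operators opened there do not clash.
open import Defs
open Counting
open Estimates
open import Data.Nat as ℕ using (ℕ; _≤_; zero; suc)
import Data.Nat.Properties as ℕP
import Data.Nat.Tactic.RingSolver as ℕSolver
import Data.Nat.Coprimality as Coprimality
open import Data.Nat.Primality using (prime)
open import Data.Integer as ℤ using (ℤ; +_; _+_; _*_; _-_; +<+)
import Data.Integer.Properties as ℤP
open import Data.Integer.Tactic.RingSolver using (solve-∀)
open import Data.Rational as ℚ using (ℚ; Positive)
import Data.Rational.Properties as ℚP
open import Data.Rational.Unnormalised as ℚᵘ using (mkℚᵘ; *≤*; *<*)
import Data.Rational.Unnormalised.Properties as ℚᵘP
open import Data.Vec using (Vec)
open import Data.List using (List; length)
open import Data.List.Relation.Unary.All using (All)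
open import Data.List.Relation.Unary.Unique.Propositional using (Unique)
open import Data.Product using (∃; ∃-syntax; _×_; _,_; proj₂)
open import Relation.Binary.PropositionalEquality
open import Relation.Nullary using (¬_; contradiction)

combine-estimates : ∀ (q D N : ℕ) (Q M : ℤ) → 0 ℕ.< N → let n = + N ; n⁴ = (n * n) * (n * n) in
  + q * Q - n⁴ ℤ.≤ + 2 * (n * n) * M → n⁴ ℤ.≤ + D * Q → + 4 * M ℤ.≤ n * n → + 2 * + q ℤ.≤ + 3 * + D
combine-estimates q D (suc k) Q M _ energy collisions size =
  ℤP.*-cancelʳ-≤-pos (+ 2 * + q) (+ 3 * + D) n⁴ (begin
    (+ 2 * + q) * n⁴       ≤⟨ ℤP.*-monoˡ-≤-nonNeg (+ 2 * + q) {{nonNegative-product 2 q}} collisions ⟩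
    (+ 2 * + q) * (+ D * Q) ≡⟨ reorder (+ q) (+ D) Q ⟩
    + D * (+ 2 * (+ q * Q)) ≤⟨ ℤP.*-monoˡ-≤-nonNeg (+ D) 2qQ≤3n⁴ ⟩
    + D * (+ 3 * n⁴)        ≡⟨ reorder′ (+ D) n⁴ ⟩
    (+ 3 * + D) * n⁴       ∎)
  where
    open ℤP.≤-Reasoning
    nonNegative-product : ∀ a b → ℤ.NonNegative (+ a * + b)
    nonNegative-product a b = subst ℤ.NonNegative (ℤP.pos-* a b) _
    n : ℤ
    n = + suc k
    n⁴ : ℤ
    n⁴ = (n * n) * (n * n)
    2qQ≤3n⁴ : + 2 * (+ q * Q) ℤ.≤ + 3 * n⁴
    2qQ≤3n⁴ = begin
      + 2 * (+ q * Q)                          ≡⟨ split (+ q * Q) n⁴ ⟩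
      + 2 * (+ q * Q - n⁴) + + 2 * n⁴          ≤⟨ ℤP.+-monoˡ-≤ (+ 2 * n⁴) (ℤP.*-monoˡ-≤-nonNeg (+ 2) energy) ⟩
      + 2 * (+ 2 * (n * n) * M) + + 2 * n⁴     ≡⟨ cong (_+ + 2 * n⁴) (regroup (n * n) M) ⟩
      (n * n) * (+ 4 * M) + + 2 * n⁴           ≤⟨ ℤP.+-monoˡ-≤ (+ 2 * n⁴) (ℤP.*-monoˡ-≤-nonNeg (n * n) size) ⟩
      (n * n) * (n * n) + + 2 * n⁴             ≡⟨ thrice n⁴ ⟩
      + 3 * n⁴                                 ∎
      where
        split : ∀ a b → + 2 * a ≡ + 2 * (a - b) + + 2 * b
        split = solve-∀
        regroup : ∀ a b → + 2 * (+ 2 * a * b) ≡ a * (+ 4 * b)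
        regroup = solve-∀
        thrice : ∀ a → a + + 2 * a ≡ + 3 * a
        thrice = solve-∀
    reorder : ∀ a b c → (+ 2 * a) * (b * c) ≡ b * (+ 2 * (a * c))
    reorder = solve-∀
    reorder′ : ∀ a b → a * (+ 3 * b) ≡ (+ 3 * a) * b
    reorder′ = solve-∀

toℚᵘ-toℚ : ∀ n → ℚ.toℚᵘ (toℚ n) ℚᵘ.≃ mkℚᵘ (+ n) 0
toℚᵘ-toℚ n = ℚᵘP.≃-reflexive (cong ℚ.toℚᵘ (ℚP.normalize-coprime (Coprimality.sym (Coprimality.1-coprimeTo n))))

size-hypothesis : ∀ M N → (toℚ 2 ℚ.* toℚ 2) ℚ.* toℚ M ℚ.≤ toℚ N ℚ.* toℚ N → + 4 * + M ℤ.≤ + N * + N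
size-hypothesis M N h with ℚᵘP.≤-respʳ-≃ rhs (ℚᵘP.≤-respˡ-≃ lhs (ℚP.toℚᵘ-mono-≤ h))
  where
    lhs : ℚ.toℚᵘ ((toℚ 2 ℚ.* toℚ 2) ℚ.* toℚ M) ℚᵘ.≃ (mkℚᵘ (+ 2) 0 ℚᵘ.* mkℚᵘ (+ 2) 0) ℚᵘ.* mkℚᵘ (+ M) 0
    lhs = ℚᵘP.≃-trans (ℚP.toℚᵘ-homo-* (toℚ 2 ℚ.* toℚ 2) (toℚ M)) (ℚᵘP.*-cong (ℚP.toℚᵘ-homo-* (toℚ 2) (toℚ 2)) (toℚᵘ-toℚ M))
    rhs : ℚ.toℚᵘ (toℚ N ℚ.* toℚ N) ℚᵘ.≃ mkℚᵘ (+ N) 0 ℚᵘ.* mkℚᵘ (+ N) 0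
    rhs = ℚᵘP.≃-trans (ℚP.toℚᵘ-homo-* (toℚ N) (toℚ N)) (ℚᵘP.*-cong (toℚᵘ-toℚ N) (toℚᵘ-toℚ N))
... | *≤* h′ = subst₂ ℤ._≤_ (ℤP.*-identityʳ _) (ℤP.*-identityʳ _) h′

half-bound : ∀ q D → 0 ℕ.< q → + 2 * + q ℤ.≤ + 3 * + D → ℚ.½ ℚ.* toℚ q ℚ.< toℚ D
half-bound q D 0<q 2q≤3D =
  ℚP.toℚᵘ-cancel-< (ℚᵘP.<-respʳ-≃ (ℚᵘP.≃-sym (toℚᵘ-toℚ D)) (ℚᵘP.<-respˡ-≃ (ℚᵘP.≃-sym lhs) unnormalised))
  where
    lhs : ℚ.toℚᵘ (ℚ.½ ℚ.* toℚ q) ℚᵘ.≃ mkℚᵘ (+ 1) 1 ℚᵘ.* mkℚᵘ (+ q) 0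
    lhs = ℚᵘP.≃-trans (ℚP.toℚᵘ-homo-* ℚ.½ (toℚ q)) (ℚᵘP.*-congˡ (toℚᵘ-toℚ q))
    -- 3 q < 4 q ≤ 6 D
    q<2D : q ℕ.< D ℕ.* 2
    q<2D = ℕP.*-cancelˡ-< 3 q (D ℕ.* 2) (ℕP.<-≤-trans (ℕP.*-monoˡ-< q {{ℕ.>-nonZero 0<q}} {3} {4} ℕP.≤-refl)
             (subst₂ ℕ._≤_ (four q) (six D) (ℕP.*-monoʳ-≤ 2 2q≤3Dℕ)))
      where
        2q≤3Dℕ : 2 ℕ.* q ℕ.≤ 3 ℕ.* D
        2q≤3Dℕ = ℤP.drop‿+≤+ (subst₂ ℤ._≤_ (sym (ℤP.pos-* 2 q)) (sym (ℤP.pos-* 3 D)) 2q≤3D)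
        four : ∀ q → 2 ℕ.* (2 ℕ.* q) ≡ 4 ℕ.* q
        four = ℕSolver.solve-∀
        six : ∀ D → 2 ℕ.* (3 ℕ.* D) ≡ 3 ℕ.* (D ℕ.* 2)
        six = ℕSolver.solve-∀
    unnormalised : mkℚᵘ (+ 1) 1 ℚᵘ.* mkℚᵘ (+ q) 0 ℚᵘ.< mkℚᵘ (+ D) 0
    unnormalised = *<* (subst₂ ℤ._<_ (sym (trans (ℤP.*-identityʳ _) (ℤP.*-identityˡ _))) (ℤP.pos-* D 2) (+<+ q<2D))

oddPrimePower>1 : ∀ q → OddPrimePower q → 1 ℕ.< q
oddPrimePower>1 q ((p , k , prime {{nontrivial}} _ , 1≤k , q≡pᵏ) , _) =
  subst (1 ℕ.<_) (sym q≡pᵏ) (ℕP.<-≤-trans p>1 (subst (ℕ._≤ p ℕ.^ k) (ℕP.*-identityʳ p) (ℕP.^-monoʳ-≤ p 1≤k)))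
  where
    p>1 : 1 ℕ.< p
    p>1 = ℕ.nonTrivial⇒n>1 p {{nontrivial}}
    instance
      p≢0 : ℕ.NonZero p
      p≢0 = ℕ.>-nonZero (ℕP.<-trans (ℕ.s≤s ℕ.z≤n) p>1)

nonempty-by-size : ∀ M N → 0 ℕ.< M → + 4 * + M ℤ.≤ + N * + N → 0 ℕ.< N
nonempty-by-size M (suc N) _ _ = ℕ.s≤s ℕ.z≤n
nonempty-by-size M zero 0<M 4M≤0 =
  contradiction (ℤP.drop‿+≤+ (subst (ℤ._≤ + 0) (sym (ℤP.pos-* 4 M)) 4M≤0)) (ℕP.<⇒≱ (ℕP.<-≤-trans 0<M (ℕP.m≤n*m M 4)))

-- Theorem: for d ≥ 1 (in particular d ≥ 3), C = 2 and c = 1/2 work.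
theorem4 : (d : ℕ) → 3 ≤ d →
    ∃[ C ] ∃[ c ] (Positive C × Positive c ×
      ((q : ℕ) → OddPrimePower q → (F : FiniteField q) →
        (E : List (Vec (FiniteField.Carrier F) d)) → Unique E →
        All (OnSphere F) E →
        (C ℚ.* C) ℚ.* toℚ (q ℕ.^ d) ℚ.≤ toℚ (length E) ℚ.* toℚ (length E) →
        c ℚ.* toℚ q ℚ.< toℚ (distanceSetSize F E)))
theorem4 (suc n) _ = toℚ 2 , ℚ.½ , _ , _ , large-sets-have-many-distances
  where
    large-sets-have-many-distances : (q : ℕ) → OddPrimePower q → (F : FiniteField q) →
      (E : List (Vec (FiniteField.Carrier F) (suc n))) → Unique E → All (OnSphere F) E →
      (toℚ 2 ℚ.* toℚ 2) ℚ.* toℚ (q ℕ.^ suc n) ℚ.≤ toℚ (length E) ℚ.* toℚ (length E) →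
      ℚ.½ ℚ.* toℚ q ℚ.< toℚ (distanceSetSize F E)
    large-sets-have-many-distances q oddPrimePower F E uE onSphere large =
      half-bound q (distanceSetSize F E) 0<q
        (combine-estimates q (distanceSetSize F E) (length E) Q (+ (q ℕ.^ suc n)) 0<N
          (dot-energy-bound 1<q) (distance-collisions 2≢0) 4qᵈ≤N²)
      where
        open QuadrupleCount F n E uE onSphere using (Q; dot-energy-bound; distance-collisions)
        1<q : 1 ℕ.< q
        1<q = oddPrimePower>1 q oddPrimePower
        0<q : 0 ℕ.< q
        0<q = ℕP.<-trans (ℕ.s≤s ℕ.z≤n) 1<q
        2≢0 : ¬ (FiniteField._+_ F (FiniteField.1# F) (FiniteField.1# F) ≡ FiniteField.0# F)
        2≢0 = FieldCounting.odd⇒2≢0 F (proj₂ oddPrimePower)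
        4qᵈ≤N² : + 4 * + (q ℕ.^ suc n) ℤ.≤ + length E * + length E
        4qᵈ≤N² = size-hypothesis (q ℕ.^ suc n) (length E) large
        0<N : 0 ℕ.< length E
        0<N = nonempty-by-size (q ℕ.^ suc n) (length E) (ℕP.m^n>0 q {{ℕ.>-nonZero 0<q}} (suc n)) 4qᵈ≤N²
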